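{- Let $G$ be a connected graph with $c,w:V(G)\to\mathbb{N}$, let $D^*$ be a decision tree for $G$ with $c_G(D^*)=\texttt{OPT}(G)$, and for each integer $k\ge 0$ let $S_k^*$ be as defined in the context. Then $$\texttt{OPT}(G)=\sum_{k=0}^{w(G)-1} c(S_k^*).$$
   Context: Graphs are simple and connected. For $v\in V(G)$, $G-v$ is the set of connected components of $G$ with $v$ deleted. A decision tree for $G$ is a rooted tree $D$ with $V(D)=V(G)$ defined recursively: its root $r$ is a vertex of $G$, and for each connected component $H$ of $G-r$ there is exactly one child of $r$, which is the root of a decision tree for $H$ (these subtrees being all of $D-r$). For $x\in V(G)$, $Q_G(D,x)$ is the root-to-$x$ path in $D$, and $c_G(D)=\sum_{x} w(x)\sum_{q\in Q_G(D,x)}c(q)$; $\texttt{OPT}(G)$ is the minimum of $c_G(D)$ over decision trees $D$. For $f\in\{c,w\}$ and $X\subseteq V(G)$, $f(X)=\sum_{v\in X}f(v)$, $f(G)=f(V(G))$. For $v\in V(G)$, $G_{D,v}$ is the subgraph of $G$ induced by the vertices of the subtree of $D$ rooted at $v$. Let $\mathcal{R}_{D^*}(G)=\{V(G_{D^*,v}) : v\in V(G)\}$. For an integer $k\ge 0$, $\mathcal{L}_k^*$ is the family of all maximal (under inclusion) sets $H\in\mathcal{R}_{D^*}(G)$ with $w(H)\le k$ (i.e. every proper superset of $H$ in $\mathcal{R}_{D^*}(G)$ has weight $>k$), and $S_k^*=V(G)\setminus\bigcup_{H\in\mathcal{L}_k^*}H$. -}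

module Defs where

open import Data.Nat using (ℕ; zero; suc; _+_; _*_; _≤_; _≤ᵇ_; _<ᵇ_)
open import Data.Bool using (Bool; true; false; T; _∧_; _∨_; not; if_then_else_)
open import Data.Fin using (Fin; _≟_)
open import Data.List using (List; []; _∷_; map; allFin; upTo; length; lookup; _++_)
open import Data.Nat.ListAction using (sum)
open import Data.Bool.ListAction using (all; any)
open import Data.List.Relation.Unary.All using (All)
open import Data.Maybe using (Maybe; just; nothing; maybe)
open import Data.Product using (Σ; ∃; _×_; _,_)
open import Relation.Binary.PropositionalEquality using (_≡_)
open import Relation.Nullary.Decidable using (⌊_⌋)

record Graph (n : ℕ) : Set where
  field
    adj    : Fin n → Fin n → Bool
    sym    : ∀ u v → adj u v ≡ adj v u
    irrefl : ∀ v → adj v v ≡ false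
open Graph public

VSet : ℕ → Set
VSet n = Fin n → Bool

full : ∀ {n} → VSet n
full _ = true

_minus_ : ∀ {n} → VSet n → Fin n → VSet n
(X minus r) x = X x ∧ not ⌊ x ≟ r ⌋

_≐_ : ∀ {n} → VSet n → VSet n → Set
H ≐ H' = ∀ x → H x ≡ H' x

ΣV : ∀ {n} → (Fin n → ℕ) → ℕ
ΣV {n} f = sum (map f (allFin n))

weight : ∀ {n} → (Fin n → ℕ) → VSet n → ℕ
weight f X = ΣV (λ x → if X x then f x else 0)

data Walk {n} (G : Graph n) (X : VSet n) : Fin n → Fin n → Set where
  here : ∀ {u} → T (X u) → Walk G X u u
  step : ∀ {u v y} → T (X u) → T (adj G u v) → Walk G X v y → Walk G X u y

Connected : ∀ {n} → Graph n → Set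
Connected G = ∀ u v → Walk G full u v

-- H is (the vertex set of) a connected component of G[X]:
-- nonempty, contained in X, connected, and closed under adjacency inside X.
IsComponent : ∀ {n} → Graph n → VSet n → VSet n → Set
IsComponent G X H =
  (∀ x → T (H x) → T (X x)) ×
  (∃ λ x → T (H x)) ×
  (∀ u v → T (H u) → T (H v) → Walk G H u v) ×
  (∀ u v → T (H u) → T (X v) → T (adj G u v) → T (H v))

data Tree (n : ℕ) : Set where
  node : Fin n → List (Tree n) → Tree n

mutual
  vset : ∀ {n} → Tree n → VSet n
  vset (node r ts) x = ⌊ x ≟ r ⌋ ∨ vsetL ts x

  vsetL : ∀ {n} → List (Tree n) → VSet n
  vsetL [] x = false
  vsetL (t ∷ ts) x = vset t x ∨ vsetL ts x

-- D is a decision tree for G[X]: root r ∈ X; every child is a decision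
-- tree for a connected component of G[X] - r (namely of its own vertex
-- set), and every component of G[X] - r is the vertex set of exactly one child.
data IsDT {n} (G : Graph n) (X : VSet n) : Tree n → Set where
  dt : ∀ {r ts} →
       T (X r) →
       All (λ t → IsComponent G (X minus r) (vset t) × IsDT G (vset t) t) ts →
       (∀ H → IsComponent G (X minus r) H →
          Σ (Fin (length ts)) λ i →
            (vset (lookup ts i) ≐ H) ×
            (∀ j → vset (lookup ts j) ≐ H → j ≡ i)) →
       IsDT G X (node r ts)

-- Q_G(D,x): root-to-x path in D (nothing if x ∉ V(D))
mutual
  Q : ∀ {n} → Tree n → Fin n → Maybe (List (Fin n))
  Q (node r ts) x = if ⌊ x ≟ r ⌋ then just (r ∷ []) else extend r (QL ts x)

  QL : ∀ {n} → List (Tree n) → Fin n → Maybe (List (Fin n))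
  QL [] x = nothing
  QL (t ∷ ts) x with Q t x
  ... | just p  = just p
  ... | nothing = QL ts x

  extend : ∀ {n} → Fin n → Maybe (List (Fin n)) → Maybe (List (Fin n))
  extend r (just p) = just (r ∷ p)
  extend r nothing  = nothing

cost : ∀ {n} → (c w : Fin n → ℕ) → Tree n → ℕ
cost c w D = ΣV (λ x → w x * maybe (λ p → sum (map c p)) 0 (Q D x))

IsOPT : ∀ {n} → Graph n → (c w : Fin n → ℕ) → ℕ → Set
IsOPT G c w m =
  (Σ (Tree _) λ D → IsDT G full D × cost c w D ≡ m) ×
  (∀ D → IsDT G full D → m ≤ cost c w D)

mutual
  subtrees : ∀ {n} → Tree n → List (Tree n)
  subtrees (node r ts) = node r ts ∷ subtreesL ts

  subtreesL : ∀ {n} → List (Tree n) → List (Tree n)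
  subtreesL [] = []
  subtreesL (t ∷ ts) = subtrees t ++ subtreesL ts

-- R_D(G) = { V(G_{D,v}) : v ∈ V(G) }   (as a list, one entry per vertex of D)
R : ∀ {n} → Tree n → List (VSet n)
R D = map vset (subtrees D)

_⊆ᵇ_ : ∀ {n} → VSet n → VSet n → Bool
_⊆ᵇ_ {n} H H' = all (λ x → not (H x) ∨ H' x) (allFin n)

_⊂ᵇ_ : ∀ {n} → VSet n → VSet n → Bool
H ⊂ᵇ H' = (H ⊆ᵇ H') ∧ not (H' ⊆ᵇ H)

inL : ∀ {n} → (w : Fin n → ℕ) → Tree n → ℕ → VSet n → Bool
inL w D k H = (weight w H ≤ᵇ k) ∧ all (λ H' → not (H ⊂ᵇ H') ∨ (k <ᵇ weight w H')) (R D)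

inS : ∀ {n} → (w : Fin n → ℕ) → Tree n → ℕ → VSet n
inS w D k x = not (any (λ H → inL w D k H ∧ H x) (R D))

module Submission where

-- Let μ(x) be the least weight of a set of R_D containing x (the sets of R_D containing x are
-- the subtrees through x, so μ(x) is the weight of the subtree rooted at x). For k < w(G),
-- x ∈ S_k exactly when k < μ(x): if some member of R_D of weight ≤ k contains x, a largest such
-- member lies in L_k. Hence Σ_k c(S_k) = Σ_x c(x) μ(x). On the other side, exchanging the sums
-- in c_G(D) charges every vertex q with c(q) times the weight of the subtree rooted at q, and an
-- induction over D shows that this is again Σ_x c(x) μ(x).

open import Defs renaming (sym to adj-sym)
open import Data.Nat.Properties
  using (+-*-semiring; +-identityʳ; *-zeroʳ; *-comm; *-distribˡ-+; +-mono-≤; +-mono-<-≤; +-mono-≤-<;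
         ≤-refl; ≤-trans; ≤-reflexive; ≤-<-trans; <-irrefl; <⇒≱; ≮⇒≥; ≰⇒>;
         ⊓-idem; ⊓-assoc; ⊓-sel; m⊓n≤m; m⊓n≤n; m≤n⇒m⊓n≡m; m≥n⇒m⊓n≡n;
         <ᵇ⇒<; <⇒<ᵇ; ≤ᵇ⇒≤; ≤⇒≤ᵇ)
open import Algebra.Properties.Semiring.Sum +-*-semiring
  using (sum-syntax; ∑-distrib-+; ∑-comm; sum-cong-≗; sum-replicate-zero; *-distribˡ-sum)
open import Data.Bool using (Bool; true; false; T; _∧_; _∨_; not; if_then_else_)
open import Data.Bool.ListAction using (all; any)
open import Data.Bool.Properties using (T-∧; T-∨; T-≡)
open import Data.Empty using (⊥-elim)
open import Data.Fin using (Fin; zero; suc; toℕ; _≟_)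
open import Data.Fin.Properties using (suc-injective; 0≢1+n; toℕ<n)
open import Data.List
  using (List; []; _∷_; _++_; map; foldr; filter; allFin; upTo; applyUpTo; tabulate; length; lookup)
open import Data.List.Extrema.Nat using (argmax; argmax-all; f[xs]≤f[argmax])
open import Data.List.Membership.Propositional using (_∈_; lose; find)
open import Data.List.Membership.Propositional.Properties using (∈-allFin; ∈-filter⁺; ∈-filter⁻; ∈-lookup)
open import Data.List.Properties using (map-tabulate; map-applyUpTo; map-++)
open import Data.List.Relation.Unary.All as All using (All; []; _∷_)
open import Data.List.Relation.Unary.All.Properties using (all⁺; all⁻; ¬All⇒Any¬)
open import Data.List.Relation.Unary.Any as Any using (here; there)
open import Data.List.Relation.Unary.Any.Properties using (any⁺; any⁻)
open import Data.Maybe using (just; nothing; maybe; is-just)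
open import Data.Nat using (ℕ; zero; suc; _+_; _*_; _⊓_; _≤_; _<_; _≤ᵇ_; _<ᵇ_; _≤?_; _<?_; z≤n; s≤s)
open import Data.Nat.ListAction using (sum)
open import Data.Product using (Σ; ∃; _×_; _,_; proj₁; proj₂)
open import Data.Sum using (_⊎_; inj₁; inj₂)
open import Data.Unit using (⊤)
open import Function using (_∘_; id)
open import Function.Bundles using (Equivalence)
open import Relation.Binary.PropositionalEquality
open import Relation.Nullary using (¬_)
open import Relation.Nullary.Decidable using (⌊_⌋; yes; no; T?; toWitness; fromWitness)

T-ext : ∀ {a b} → (T a → T b) → (T b → T a) → a ≡ b
T-ext {false} {false} _ _ = refl
T-ext {false} {true} _ b⇒a = ⊥-elim (b⇒a _)
T-ext {true} {false} a⇒b _ = ⊥-elim (a⇒b _)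
T-ext {true} {true} _ _ = refl

T-not⁺ : ∀ {a} → ¬ T a → T (not a)
T-not⁺ {false} _ = _
T-not⁺ {true} ¬a = ¬a _

T-not⁻ : ∀ {a} → T (not a) → ¬ T a
T-not⁻ {false} _ ()

¬T⇒≡false : ∀ {a} → ¬ T a → a ≡ false
¬T⇒≡false {false} _ = refl
¬T⇒≡false {true} ¬a = ⊥-elim (¬a _)

≡false⇒¬T : ∀ {a} → a ≡ false → ¬ T a
≡false⇒¬T refl ()

¬T-∨ : ∀ {a b} → ¬ T (a ∨ b) → ¬ T a × ¬ T b
¬T-∨ ¬a∨b = ¬a∨b ∘ Equivalence.from T-∨ ∘ inj₁ , ¬a∨b ∘ Equivalence.from T-∨ ∘ inj₂

implies : ∀ {a b} → T (not a ∨ b) → T a → T b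
implies {true} b _ = b

implies-intro : ∀ {a b} → (T a → T b) → T (not a ∨ b)
implies-intro {false} _ = _
implies-intro {true} a⇒b = a⇒b _

implies-counterexample : ∀ {a b} → ¬ T (not a ∨ b) → T a × ¬ T b
implies-counterexample {false} ¬a⇒b = ⊥-elim (¬a⇒b _)
implies-counterexample {true} ¬a⇒b = _ , ¬a⇒b

if-mono : ∀ {a b} m → (T a → T b) → (if a then m else 0) ≤ (if b then m else 0)
if-mono {false} m _ = z≤n
if-mono {true} {true} m _ = ≤-refl
if-mono {true} {false} m a⇒b = ⊥-elim (a⇒b _)

sum-tabulate : ∀ {n} (f : Fin n → ℕ) → sum (tabulate f) ≡ ∑[ x < n ] f x
sum-tabulate {zero} f = refl
sum-tabulate {suc n} f = cong (f zero +_) (sum-tabulate (f ∘ suc))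

ΣV≡∑ : ∀ {n} (f : Fin n → ℕ) → ΣV f ≡ ∑[ x < n ] f x
ΣV≡∑ f = trans (cong sum (map-tabulate id f)) (sum-tabulate f)

sum-applyUpTo : ∀ n (g : ℕ → ℕ) → sum (applyUpTo g n) ≡ ∑[ k < n ] g (toℕ k)
sum-applyUpTo zero g = refl
sum-applyUpTo (suc n) g = cong (g 0 +_) (sum-applyUpTo n (g ∘ suc))

sum-upTo : ∀ n (g : ℕ → ℕ) → sum (map g (upTo n)) ≡ ∑[ k < n ] g (toℕ k)
sum-upTo n g = trans (cong sum (map-applyUpTo id g n)) (sum-applyUpTo n g)

∑-mono-≤ : ∀ {n} {f g : Fin n → ℕ} → (∀ x → f x ≤ g x) → ∑[ x < n ] f x ≤ ∑[ x < n ] g x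
∑-mono-≤ {zero} f≤g = z≤n
∑-mono-≤ {suc n} f≤g = +-mono-≤ (f≤g zero) (∑-mono-≤ (f≤g ∘ suc))

∑-mono-< : ∀ {n} {f g : Fin n → ℕ} → (∀ x → f x ≤ g x) → ∀ v → f v < g v →
           ∑[ x < n ] f x < ∑[ x < n ] g x
∑-mono-< f≤g zero fv<gv = +-mono-<-≤ fv<gv (∑-mono-≤ (f≤g ∘ suc))
∑-mono-< f≤g (suc v) fv<gv = +-mono-≤-< (f≤g zero) (∑-mono-< (f≤g ∘ suc) v fv<gv)

∑-indicator : ∀ {n} (r : Fin n) a → ∑[ x < n ] (if ⌊ x ≟ r ⌋ then a else 0) ≡ a
∑-indicator {suc n} zero a = trans (cong (a +_) (sum-replicate-zero n)) (+-identityʳ a)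
∑-indicator {suc n} (suc r) a =
  trans (sum-cong-≗ (λ x → cong (if_then a else 0) (suc≟suc x))) (∑-indicator r a)
  where
  suc≟suc : ∀ x → ⌊ suc x ≟ suc r ⌋ ≡ ⌊ x ≟ r ⌋
  suc≟suc x with x ≟ r
  ... | yes _ = refl
  ... | no _ = refl

∑-threshold : ∀ {N m} a → m ≤ N → ∑[ k < N ] (if toℕ k <ᵇ m then a else 0) ≡ m * a
∑-threshold {zero} a z≤n = refl
∑-threshold {suc N} {zero} a z≤n = ∑-threshold {N} a z≤n
∑-threshold {suc N} {suc m} a (s≤s m≤N) = cong (a +_) (∑-threshold a m≤N)

∑-layers : ∀ {n} (c μ : Fin n → ℕ) {N} → (∀ x → μ x ≤ N) →
           ∑[ x < n ] (c x * μ x) ≡ ∑[ k < N ] ∑[ x < n ] (if toℕ k <ᵇ μ x then c x else 0)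
∑-layers {n} c μ {N} μ≤N =
  trans (sum-cong-≗ λ x → trans (*-comm (c x) (μ x)) (sym (∑-threshold (c x) (μ≤N x))))
        (∑-comm {n} {N} (λ x k → if toℕ k <ᵇ μ x then c x else 0))

module _ {n : ℕ} where

  infix 4 _⊆_

  _⊆_ : VSet n → VSet n → Set
  H ⊆ H' = ∀ {x} → T (H x) → T (H' x)

  ⊆ᵇ⇒⊆ : ∀ {H H'} → T (H ⊆ᵇ H') → H ⊆ H'
  ⊆ᵇ⇒⊆ H⊆H' {x} = implies (All.lookup (all⁺ _ (allFin n) H⊆H') (∈-allFin x))

  ⊆⇒⊆ᵇ : ∀ {H H'} → H ⊆ H' → T (H ⊆ᵇ H')
  ⊆⇒⊆ᵇ {H} {H'} H⊆H' =
    all⁻ (λ x → not (H x) ∨ H' x) {allFin n} (All.tabulate λ _ → implies-intro H⊆H')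

  ¬⊆ᵇ⇒witness : ∀ {H H'} → ¬ T (H ⊆ᵇ H') → ∃ λ x → T (H x) × ¬ T (H' x)
  ¬⊆ᵇ⇒witness H⊈H' with Any.satisfied (¬All⇒Any¬ (T? ∘ _) (allFin n) (H⊈H' ∘ all⁻ _))
  ... | x , ¬x⇒ = x , implies-counterexample ¬x⇒

  weight≡∑ : ∀ (f : Fin n → ℕ) H → weight f H ≡ ∑[ x < n ] (if H x then f x else 0)
  weight≡∑ f H = ΣV≡∑ (λ x → if H x then f x else 0)

  weight-mono : ∀ (f : Fin n → ℕ) {H H'} → H ⊆ H' → weight f H ≤ weight f H'
  weight-mono f {H} {H'} H⊆H' =
    subst₂ _≤_ (sym (weight≡∑ f H)) (sym (weight≡∑ f H')) (∑-mono-≤ λ x → if-mono (f x) H⊆H')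

  weight-scale : ∀ (f : Fin n → ℕ) a H → ∑[ x < n ] (f x * (if H x then a else 0)) ≡ a * weight f H
  weight-scale f a H = begin
    ∑[ x < n ] (f x * (if H x then a else 0))  ≡⟨ sum-cong-≗ (λ x → swap-if (H x) (f x)) ⟩
    ∑[ x < n ] (a * (if H x then f x else 0))  ≡⟨ sym (*-distribˡ-sum a (λ x → if H x then f x else 0)) ⟩
    a * ∑[ x < n ] (if H x then f x else 0)    ≡⟨ cong (a *_) (sym (weight≡∑ f H)) ⟩
    a * weight f H                             ∎
    where
    open ≡-Reasoning
    swap-if : ∀ b m → m * (if b then a else 0) ≡ a * (if b then m else 0)
    swap-if true m = *-comm m a
    swap-if false m = trans (*-zeroʳ m) (sym (*-zeroʳ a))

  size : VSet n → ℕ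
  size = weight (λ _ → 1)

  size≤n : ∀ H → size H ≤ n
  size≤n H =
    subst₂ _≤_ (sym (weight≡∑ (λ _ → 1) H)) (∑-one n)
               (∑-mono-≤ {f = λ x → if H x then 1 else 0} {g = λ _ → 1} λ _ → if-mono {b = true} 1 _)
    where
    ∑-one : ∀ n → ∑[ x < n ] 1 ≡ n
    ∑-one zero = refl
    ∑-one (suc n) = cong suc (∑-one n)

  size-mono-< : ∀ {H H'} → H ⊆ H' → ∀ {x} → T (H' x) → ¬ T (H x) → size H < size H'
  size-mono-< {H} {H'} H⊆H' {x} H'x ¬Hx =
    subst₂ _<_ (sym (weight≡∑ (λ _ → 1) H)) (sym (weight≡∑ (λ _ → 1) H'))
               (∑-mono-< (λ _ → if-mono 1 H⊆H') x (new (H x) (H' x) ¬Hx H'x))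
    where
    new : ∀ a b → ¬ T a → T b → (if a then 1 else 0) < (if b then 1 else 0)
    new false true _ _ = s≤s z≤n
    new true _ ¬a _ = ⊥-elim (¬a _)

  ⊂ᵇ⇒⊆ : ∀ {H H'} → T (H ⊂ᵇ H') → H ⊆ H'
  ⊂ᵇ⇒⊆ {H} {H'} H⊂H' = ⊆ᵇ⇒⊆ {H} {H'} (proj₁ (Equivalence.to (T-∧ {H ⊆ᵇ H'}) H⊂H'))

  ⊂ᵇ⇒size< : ∀ {H H'} → T (H ⊂ᵇ H') → size H < size H'
  ⊂ᵇ⇒size< {H} {H'} H⊂H' =
    let H⊆H' , H'⊈H = Equivalence.to (T-∧ {H ⊆ᵇ H'}) H⊂H'
        _ , H'x , ¬Hx = ¬⊆ᵇ⇒witness {H'} {H} (T-not⁻ H'⊈H)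
    in size-mono-< {H} {H'} (⊆ᵇ⇒⊆ {H} {H'} H⊆H') H'x ¬Hx

mutual
  vset≡is-just-Q : ∀ {n} (t : Tree n) x → vset t x ≡ is-just (Q t x)
  vset≡is-just-Q (node r ts) x with x ≟ r
  ... | yes _ = refl
  ... | no _ = trans (vsetL≡is-just-QL ts x) (is-just-extend (QL ts x))
    where
    is-just-extend : ∀ m → is-just m ≡ is-just (extend r m)
    is-just-extend (just _) = refl
    is-just-extend nothing = refl

  vsetL≡is-just-QL : ∀ {n} (ts : List (Tree n)) x → vsetL ts x ≡ is-just (QL ts x)
  vsetL≡is-just-QL [] x = refl
  vsetL≡is-just-QL (t ∷ ts) x rewrite vset≡is-just-Q t x with Q t x
  ... | just _ = refl
  ... | nothing = vsetL≡is-just-QL ts x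

vset∈R : ∀ {n} (t : Tree n) → vset t ∈ R t
vset∈R (node _ _) = here refl

RL : ∀ {n} → List (Tree n) → List (VSet n)
RL ts = map vset (subtreesL ts)

RL-∷ : ∀ {n} (t : Tree n) ts → RL (t ∷ ts) ≡ R t ++ RL ts
RL-∷ t ts = map-++ vset (subtrees t) (subtreesL ts)

vsetL-lookup⁻ : ∀ {n} (ts : List (Tree n)) {x} → T (vsetL ts x) → ∃ λ i → T (vset (lookup ts i) x)
vsetL-lookup⁻ (t ∷ ts) {x} x∈ts with Equivalence.to (T-∨ {vset t x}) x∈ts
... | inj₁ x∈t = zero , x∈t
... | inj₂ x∈ts' = let i , x∈tᵢ = vsetL-lookup⁻ ts x∈ts' in suc i , x∈tᵢ

vsetL-lookup⁺ : ∀ {n} (ts : List (Tree n)) {x} i → T (vset (lookup ts i) x) → T (vsetL ts x)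
vsetL-lookup⁺ (t ∷ ts) zero x∈t = Equivalence.from T-∨ (inj₁ x∈t)
vsetL-lookup⁺ (t ∷ ts) (suc i) x∈tᵢ = Equivalence.from T-∨ (inj₂ (vsetL-lookup⁺ ts i x∈tᵢ))

PairwiseDisjoint : ∀ {n} → List (Tree n) → Set
PairwiseDisjoint [] = ⊤
PairwiseDisjoint (t ∷ ts) = (∀ {x} → T (vset t x) → ¬ T (vsetL ts x)) × PairwiseDisjoint ts

index-injective⇒pairwiseDisjoint :
  ∀ {n} (ts : List (Tree n)) →
  (∀ i j {x} → T (vset (lookup ts i) x) → T (vset (lookup ts j) x) → i ≡ j) → PairwiseDisjoint ts
index-injective⇒pairwiseDisjoint [] _ = _
index-injective⇒pairwiseDisjoint (t ∷ ts) same-index =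
  (λ x∈t x∈ts → let j , x∈tⱼ = vsetL-lookup⁻ ts x∈ts in 0≢1+n (same-index zero (suc j) x∈t x∈tⱼ)) ,
  index-injective⇒pairwiseDisjoint ts
    λ i j x∈tᵢ x∈tⱼ → suc-injective (same-index (suc i) (suc j) x∈tᵢ x∈tⱼ)

module Walks {n : ℕ} (G : Graph n) where

  ClosedIn : VSet n → VSet n → Set
  ClosedIn X H = ∀ u v → T (H u) → T (X v) → T (adj G u v) → T (H v)

  walk-start : ∀ {X u v} → Walk G X u v → T (X u)
  walk-start (here Xu) = Xu
  walk-start (step Xu _ _) = Xu

  walk-mono : ∀ {X Y} → X ⊆ Y → ∀ {u v} → Walk G X u v → Walk G Y u v
  walk-mono X⊆Y (here Xu) = here (X⊆Y Xu)
  walk-mono X⊆Y (step Xu uv walk) = step (X⊆Y Xu) uv (walk-mono X⊆Y walk)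

  walk-++ : ∀ {X u v y} → Walk G X u v → Walk G X v y → Walk G X u y
  walk-++ (here _) walk = walk
  walk-++ (step Xu uv walk) walk' = step Xu uv (walk-++ walk walk')

  walk-reverse : ∀ {X u v} → Walk G X u v → Walk G X v u
  walk-reverse (here Xu) = here Xu
  walk-reverse {u = u} (step {v = v} Xu uv walk) =
    walk-++ (walk-reverse walk) (step (walk-start walk) (subst T (adj-sym G u v) uv) (here Xu))

  walk-stays : ∀ {X Y H} → Y ⊆ X → ClosedIn X H → ∀ {u v} → Walk G Y u v → T (H u) → T (H v)
  walk-stays Y⊆X closed (here _) Hu = Hu
  walk-stays Y⊆X closed (step {u} {v} _ uv walk) Hu =
    walk-stays Y⊆X closed walk (closed u v Hu (Y⊆X (walk-start walk)) uv)

  components-≐ : ∀ {X H₁ H₂ x} → IsComponent G X H₁ → IsComponent G X H₂ → T (H₁ x) → T (H₂ x) → H₁ ≐ H₂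
  components-≐ {x = x} (H₁⊆X , _ , walks₁ , closed₁) (H₂⊆X , _ , walks₂ , closed₂) H₁x H₂x y =
    T-ext (λ H₁y → walk-stays (H₁⊆X _) closed₂ (walks₁ x y H₁x H₁y) H₂x)
          (λ H₂y → walk-stays (H₂⊆X _) closed₁ (walks₂ x y H₂x H₂y) H₁x)

-- Each step that is not yet closed adds a vertex, so n + 1 steps reach a closed set.
module Saturation {n : ℕ} (f : VSet n → VSet n)
                  (f-inflationary : ∀ S → S ⊆ f S)
                  (f-mono : ∀ {S S'} → S ⊆ S' → f S ⊆ f S') where

  iter : VSet n → ℕ → VSet n
  iter S zero = S
  iter S (suc i) = f (iter S i)

  iter-closed-or-large : ∀ S i → (f (iter S i) ⊆ iter S i) ⊎ (i ≤ size (iter S i))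
  iter-closed-or-large S zero = inj₂ z≤n
  iter-closed-or-large S (suc i) with f (iter S i) ⊆ᵇ iter S i in closed
  ... | true = inj₁ (f-mono (⊆ᵇ⇒⊆ {H = f (iter S i)} (Equivalence.from T-≡ closed)))
  ... | false with iter-closed-or-large S i
  ...   | inj₁ f-closed = ⊥-elim (≡false⇒¬T closed (⊆⇒⊆ᵇ {H = f (iter S i)} f-closed))
  ...   | inj₂ i≤size =
    let _ , fx , ¬x = ¬⊆ᵇ⇒witness {H = f (iter S i)} (≡false⇒¬T closed)
    in inj₂ (≤-<-trans i≤size
                       (size-mono-< {H = iter S i} {H' = f (iter S i)} (f-inflationary (iter S i)) fx ¬x))

  saturate : VSet n → VSet n
  saturate S = iter S (suc n)

  saturate-closed : ∀ S → f (saturate S) ⊆ saturate S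
  saturate-closed S with iter-closed-or-large S (suc n)
  ... | inj₁ closed = closed
  ... | inj₂ large = ⊥-elim (<⇒≱ large (size≤n (saturate S)))

  saturate-induction : (P : VSet n → Set) → (∀ S → P S → P (f S)) → ∀ S → P S → P (saturate S)
  saturate-induction P preserved S PS = go (suc n)
    where
    go : ∀ i → P (iter S i)
    go zero = PS
    go (suc i) = preserved (iter S i) (go i)

module Components {n : ℕ} (G : Graph n) (X : VSet n) where

  open Walks G

  grow : VSet n → VSet n
  grow S v = S v ∨ (X v ∧ any (λ u → S u ∧ adj G u v) (allFin n))

  grow-inflationary : ∀ S → S ⊆ grow S
  grow-inflationary S Sv = Equivalence.from T-∨ (inj₁ Sv)

  grow-new : ∀ {S u v} → T (S u) → T (X v) → T (adj G u v) → T (grow S v)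
  grow-new {S} {u} Su Xv uv = Equivalence.from T-∨ (inj₂ (Equivalence.from T-∧
    (Xv , any⁺ _ (lose (∈-allFin u) (Equivalence.from T-∧ (Su , uv))))))

  grow-cases : ∀ {S v} → T (grow S v) → T (S v) ⊎ (T (X v) × ∃ λ u → T (S u) × T (adj G u v))
  grow-cases {S} {v} Sv⁺ with Equivalence.to (T-∨ {S v}) Sv⁺
  ... | inj₁ Sv = inj₁ Sv
  ... | inj₂ new =
    let Xv , some = Equivalence.to (T-∧ {X v}) new
        u , _ , Su∧uv = find (any⁻ _ (allFin n) some)
    in inj₂ (Xv , u , Equivalence.to (T-∧ {S u}) Su∧uv)

  grow-mono : ∀ {S S'} → S ⊆ S' → grow S ⊆ grow S'
  grow-mono {S' = S'} S⊆S' Sv⁺ with grow-cases Sv⁺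
  ... | inj₁ Sv = grow-inflationary S' (S⊆S' Sv)
  ... | inj₂ (Xv , u , Su , uv) = grow-new (S⊆S' Su) Xv uv

  open Saturation grow grow-inflationary grow-mono

  module _ {x : Fin n} (Xx : T (X x)) where

    C : VSet n
    C = saturate (λ v → ⌊ v ≟ x ⌋)

    C⊆X : ∀ v → T (C v) → T (X v)
    C⊆X v = saturate-induction (_⊆ X) preserved _ base
      where
      base : (λ v → ⌊ v ≟ x ⌋) ⊆ X
      base v≟x with refl ← toWitness v≟x = Xx
      preserved : ∀ S → S ⊆ X → grow S ⊆ X
      preserved S S⊆X Sv⁺ with grow-cases Sv⁺
      ... | inj₁ Sv = S⊆X Sv
      ... | inj₂ (Xv , _) = Xv

    x∈C : T (C x)
    x∈C = saturate-induction (λ S → T (S x)) (λ S → grow-inflationary S) _ (fromWitness refl)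

    walks-from-x : ∀ {v} → T (C v) → Walk G C x v
    walks-from-x = saturate-induction (λ S → ∀ {v} → T (S v) → Walk G S x v) preserved _ base
      where
      base : ∀ {v} → T ⌊ v ≟ x ⌋ → Walk G (λ v → ⌊ v ≟ x ⌋) x v
      base v≟x with refl ← toWitness v≟x = here v≟x
      preserved : ∀ S → (∀ {v} → T (S v) → Walk G S x v) → ∀ {v} → T (grow S v) → Walk G (grow S) x v
      preserved S walks Sv⁺ with grow-cases Sv⁺
      ... | inj₁ Sv = walk-mono (grow-inflationary S) (walks Sv)
      ... | inj₂ (_ , u , Su , uv) =
        walk-++ (walk-mono (grow-inflationary S) (walks Su)) (step (grow-inflationary S Su) uv (here Sv⁺))

    C-closed : ClosedIn X C
    C-closed u v Cu Xv uv = saturate-closed _ (grow-new Cu Xv uv)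

    C-component : IsComponent G X C
    C-component =
      C⊆X , (x , x∈C) ,
      (λ u v Cu Cv → walk-++ (walk-reverse (walks-from-x Cu)) (walks-from-x Cv)) ,
      C-closed

module DecisionTrees {n : ℕ} (G : Graph n) where

  open Walks G

  ChildOf : VSet n → Fin n → Tree n → Set
  ChildOf X r t = IsComponent G (X minus r) (vset t) × IsDT G (vset t) t

  root∉children : ∀ {X r ts} → All (ChildOf X r) ts → ¬ T (vsetL ts r)
  root∉children {X} {r} {ts} children r∈ts =
    let i , r∈tᵢ = vsetL-lookup⁻ ts r∈ts
        _ , r≢r = Equivalence.to (T-∧ {X r}) (proj₁ (proj₁ (All.lookup children (∈-lookup i))) r r∈tᵢ)
    in T-not⁻ r≢r (fromWitness refl)

  children-disjoint : ∀ {X r ts} → All (ChildOf X r) ts →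
    (∀ H → IsComponent G (X minus r) H →
       Σ (Fin (length ts)) λ i → (vset (lookup ts i) ≐ H) × (∀ j → vset (lookup ts j) ≐ H → j ≡ i)) →
    PairwiseDisjoint ts
  children-disjoint {ts = ts} children unique = index-injective⇒pairwiseDisjoint ts same-index
    where
    same-index : ∀ i j {x} → T (vset (lookup ts i) x) → T (vset (lookup ts j) x) → i ≡ j
    same-index i j x∈tᵢ x∈tⱼ =
      let tᵢ-component = proj₁ (All.lookup children (∈-lookup i))
          tⱼ-component = proj₁ (All.lookup children (∈-lookup j))
          _ , _ , only = unique _ tᵢ-component
      in trans (only i (λ _ → refl)) (sym (only j (components-≐ tⱼ-component tᵢ-component x∈tⱼ x∈tᵢ)))

  vertices⊆vset : ∀ {X t} → IsDT G X t → X ⊆ vset t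
  vertices⊆vset {X} (dt {r} {ts} _ _ unique) {x} Xx with x ≟ r
  ... | yes _ = _
  ... | no x≢r =
    let X-r-x = Equivalence.from T-∧ (Xx , T-not⁺ (x≢r ∘ toWitness))
        i , tᵢ≐C , _ = unique _ (Components.C-component G (X minus r) X-r-x)
    in vsetL-lookup⁺ ts i (subst T (sym (tᵢ≐C x)) (Components.x∈C G (X minus r) X-r-x))

module Threshold {n : ℕ} (w : Fin n → ℕ) where

  W : ℕ
  W = weight w full

  -- W when no member of L contains x
  minWeight : List (VSet n) → Fin n → ℕ
  minWeight L x = foldr (λ H m → if H x then weight w H ⊓ m else m) W L

  minWeight≤W : ∀ L x → minWeight L x ≤ W
  minWeight≤W [] x = ≤-refl
  minWeight≤W (H ∷ L) x with H x
  ... | true = ≤-trans (m⊓n≤n _ _) (minWeight≤W L x)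
  ... | false = minWeight≤W L x

  minWeight≤weight : ∀ {L H x} → H ∈ L → T (H x) → minWeight L x ≤ weight w H
  minWeight≤weight {H ∷ L} {x = x} (here refl) Hx with H x
  ... | true = m⊓n≤m _ _
  minWeight≤weight {H' ∷ L} {x = x} (there H∈L) Hx with H' x
  ... | true = ≤-trans (m⊓n≤n _ _) (minWeight≤weight H∈L Hx)
  ... | false = minWeight≤weight H∈L Hx

  minWeight-attained : ∀ L x → minWeight L x < W → ∃ λ H → H ∈ L × T (H x) × weight w H ≤ minWeight L x
  minWeight-attained [] x μ<W = ⊥-elim (<-irrefl refl μ<W)
  minWeight-attained (H ∷ L) x μ<W with H x in Hx
  ... | false = let H' , H'∈L , rest = minWeight-attained L x μ<W in H' , there H'∈L , rest
  ... | true with ⊓-sel (weight w H) (minWeight L x)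
  ...   | inj₁ μ≡wH = H , here refl , Equivalence.from T-≡ Hx , ≤-reflexive (sym μ≡wH)
  ...   | inj₂ μ≡μL =
    let H' , H'∈L , H'x , wH'≤ = minWeight-attained L x (subst (_< W) μ≡μL μ<W)
    in H' , there H'∈L , H'x , subst (weight w H' ≤_) (sym μ≡μL) wH'≤

  minWeight-++ : ∀ A B x → minWeight (A ++ B) x ≡ minWeight A x ⊓ minWeight B x
  minWeight-++ [] B x = sym (m≥n⇒m⊓n≡n (minWeight≤W B x))
  minWeight-++ (H ∷ A) B x with H x
  ... | true = trans (cong (weight w H ⊓_) (minWeight-++ A B x)) (sym (⊓-assoc (weight w H) _ _))
  ... | false = minWeight-++ A B x

  minWeight-RL-∷ : ∀ t ts x → minWeight (RL (t ∷ ts)) x ≡ minWeight (R t) x ⊓ minWeight (RL ts) x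
  minWeight-RL-∷ t ts x = trans (cong (λ L → minWeight L x) (RL-∷ t ts)) (minWeight-++ (R t) (RL ts) x)

  mutual
    minWeight-outside : ∀ t {x} → ¬ T (vset t x) → minWeight (R t) x ≡ W
    minWeight-outside (node r ts) x∉t rewrite ¬T⇒≡false x∉t = minWeightL-outside ts (proj₂ (¬T-∨ x∉t))

    minWeightL-outside : ∀ ts {x} → ¬ T (vsetL ts x) → minWeight (RL ts) x ≡ W
    minWeightL-outside [] _ = refl
    minWeightL-outside (t ∷ ts) {x} x∉ =
      let x∉t , x∉ts = ¬T-∨ x∉
      in trans (minWeight-RL-∷ t ts x)
               (trans (cong₂ _⊓_ (minWeight-outside t x∉t) (minWeightL-outside ts x∉ts)) (⊓-idem W))

  minWeight-RL≤ : ∀ ts {x} → T (vsetL ts x) → minWeight (RL ts) x ≤ weight w (vsetL ts)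
  minWeight-RL≤ (t ∷ ts) {x} x∈ rewrite minWeight-RL-∷ t ts x with Equivalence.to (T-∨ {vset t x}) x∈
  ... | inj₁ x∈t =
    ≤-trans (m⊓n≤m _ _)
            (≤-trans (minWeight≤weight (vset∈R t) x∈t) (weight-mono w (Equivalence.from T-∨ ∘ inj₁)))
  ... | inj₂ x∈ts =
    ≤-trans (m⊓n≤n _ _) (≤-trans (minWeight-RL≤ ts x∈ts) (weight-mono w (Equivalence.from T-∨ ∘ inj₂)))

  -- A member of R_D of weight ≤ k containing x with the most vertices is inclusion-maximal
  -- among such members, hence in L_k.
  L-covers : ∀ D k x {H₀} → H₀ ∈ R D → T (H₀ x) → weight w H₀ ≤ k →
             T (any (λ H → inL w D k H ∧ H x) (R D))
  L-covers D k x {H₀} H₀∈R H₀x wH₀≤k =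
    any⁺ _ (lose Hmax∈R (Equivalence.from T-∧ (Equivalence.from T-∧ (wHmax≤k , Hmax-maximal) , Hmax-x)))
    where
    candidate : VSet n → Bool
    candidate H = (weight w H ≤ᵇ k) ∧ H x

    candidates : List (VSet n)
    candidates = filter (T? ∘ candidate) (R D)

    Hmax : VSet n
    Hmax = argmax size H₀ candidates

    Hmax-candidate : Hmax ∈ R D × T (candidate Hmax)
    Hmax-candidate = argmax-all size {P = λ H → H ∈ R D × T (candidate H)}
      (H₀∈R , Equivalence.from T-∧ (≤⇒≤ᵇ wH₀≤k , H₀x)) (All.tabulate (∈-filter⁻ (T? ∘ candidate)))

    Hmax∈R : Hmax ∈ R D
    Hmax∈R = proj₁ Hmax-candidate

    wHmax≤k : T (weight w Hmax ≤ᵇ k)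
    wHmax≤k = proj₁ (Equivalence.to T-∧ (proj₂ Hmax-candidate))

    Hmax-x : T (Hmax x)
    Hmax-x = proj₂ (Equivalence.to (T-∧ {weight w Hmax ≤ᵇ k}) (proj₂ Hmax-candidate))

    Hmax-largest : ∀ {H} → H ∈ R D → T (candidate H) → size H ≤ size Hmax
    Hmax-largest H∈R cand =
      All.lookup (f[xs]≤f[argmax] H₀ candidates) (∈-filter⁺ (T? ∘ candidate) H∈R cand)

    Hmax⊂⇒heavy : ∀ {H} → H ∈ R D → T (Hmax ⊂ᵇ H) → T (k <ᵇ weight w H)
    Hmax⊂⇒heavy {H} H∈R Hmax⊂H with weight w H ≤? k
    ... | no wH≰k = <⇒<ᵇ (≰⇒> wH≰k)
    ... | yes wH≤k =
      let H-candidate = Equivalence.from T-∧ (≤⇒≤ᵇ wH≤k , ⊂ᵇ⇒⊆ {H = Hmax} Hmax⊂H Hmax-x)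
      in ⊥-elim (<⇒≱ (⊂ᵇ⇒size< {H = Hmax} {H} Hmax⊂H) (Hmax-largest H∈R H-candidate))

    Hmax-maximal : T (all (λ H → not (Hmax ⊂ᵇ H) ∨ (k <ᵇ weight w H)) (R D))
    Hmax-maximal = all⁻ _ (All.tabulate λ H∈R → implies-intro (Hmax⊂⇒heavy H∈R))

  inS-threshold : ∀ D {k} x → k < W → inS w D k x ≡ (k <ᵇ minWeight (R D) x)
  inS-threshold D {k} x k<W = T-ext uncovered⇒light light⇒uncovered
    where
    μ = minWeight (R D) x

    uncovered⇒light : T (inS w D k x) → T (k <ᵇ μ)
    uncovered⇒light x∈S with k <? μ
    ... | yes k<μ = <⇒<ᵇ k<μ
    ... | no k≮μ =
      let H , H∈R , Hx , wH≤μ = minWeight-attained (R D) x (≤-<-trans (≮⇒≥ k≮μ) k<W)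
      in ⊥-elim (T-not⁻ x∈S (L-covers D k x H∈R Hx (≤-trans wH≤μ (≮⇒≥ k≮μ))))

    light⇒uncovered : T (k <ᵇ μ) → T (inS w D k x)
    light⇒uncovered k<μ = T-not⁺ λ covered →
      let H , H∈R , H∈L∧Hx = find (any⁻ _ (R D) covered)
          H∈L , Hx = Equivalence.to (T-∧ {inL w D k H}) H∈L∧Hx
          wH≤k = ≤ᵇ⇒≤ _ _ (proj₁ (Equivalence.to (T-∧ {weight w H ≤ᵇ k}) H∈L))
      in <⇒≱ (<ᵇ⇒< k μ k<μ) (≤-trans (minWeight≤weight H∈R Hx) wH≤k)

  weight-inS : ∀ D (c : Fin n → ℕ) {k} → k < W →
               weight c (inS w D k) ≡ ∑[ x < n ] (if k <ᵇ minWeight (R D) x then c x else 0)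
  weight-inS D c {k} k<W =
    trans (weight≡∑ c (inS w D k)) (sum-cong-≗ λ x → cong (if_then c x else 0) (inS-threshold D x k<W))

module Cost {n : ℕ} (c w : Fin n → ℕ) where

  open Threshold w

  pathCost : Tree n → Fin n → ℕ
  pathCost t x = maybe (λ p → sum (map c p)) 0 (Q t x)

  ownCost : Tree n → Fin n → ℕ
  ownCost t x = if vset t x then c x * minWeight (R t) x else 0

  Σ-children : (Tree n → Fin n → ℕ) → List (Tree n) → Fin n → ℕ
  Σ-children f ts x = sum (map (λ t → f t x) ts)

  pathCost-outside : ∀ t {x} → ¬ T (vset t x) → pathCost t x ≡ 0
  pathCost-outside t {x} x∉t with Q t x | vset≡is-just-Q t x
  ... | nothing | _ = refl
  ... | just _ | x∈t = ⊥-elim (x∉t (Equivalence.from T-≡ x∈t))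

  Σ-pathCost-outside : ∀ ts {x} → ¬ T (vsetL ts x) → Σ-children pathCost ts x ≡ 0
  Σ-pathCost-outside [] _ = refl
  Σ-pathCost-outside (t ∷ ts) x∉ =
    let x∉t , x∉ts = ¬T-∨ x∉ in cong₂ _+_ (pathCost-outside t x∉t) (Σ-pathCost-outside ts x∉ts)

  pathCost-below : ∀ r ts x → PairwiseDisjoint ts →
    maybe (λ p → sum (map c p)) 0 (extend r (QL ts x)) ≡
    (if vsetL ts x then c r else 0) + Σ-children pathCost ts x
  pathCost-below r [] x _ = refl
  pathCost-below r (t ∷ ts) x (t-disjoint , ts-disjoint) with Q t x | vset≡is-just-Q t x
  ... | nothing | x∉t rewrite x∉t = pathCost-below r ts x ts-disjoint
  ... | just p | x∈t rewrite x∈t = cong (c r +_) (sym (begin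
    sum (map c p) + Σ-children pathCost ts x  ≡⟨ cong (sum (map c p) +_) (Σ-pathCost-outside ts x∉ts) ⟩
    sum (map c p) + 0                         ≡⟨ +-identityʳ _ ⟩
    sum (map c p)                             ∎))
    where
    open ≡-Reasoning
    x∉ts = t-disjoint (Equivalence.from T-≡ x∈t)

  pathCost-node : ∀ r ts x → ¬ T (vsetL ts r) → PairwiseDisjoint ts →
    pathCost (node r ts) x ≡ (if vset (node r ts) x then c r else 0) + Σ-children pathCost ts x
  pathCost-node r ts x r∉ts disjoint with x ≟ r
  ... | yes refl = cong (c r +_) (sym (Σ-pathCost-outside ts r∉ts))
  ... | no _ = pathCost-below r ts x disjoint

  Σ-ownCost : ∀ ts x → PairwiseDisjoint ts →
    Σ-children ownCost ts x ≡ (if vsetL ts x then c x * minWeight (RL ts) x else 0)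
  Σ-ownCost [] x _ = refl
  Σ-ownCost (t ∷ ts) x (t-disjoint , ts-disjoint) rewrite minWeight-RL-∷ t ts x | Σ-ownCost ts x ts-disjoint
    with vset t x in x∈t
  ... | true rewrite ¬T⇒≡false (t-disjoint (Equivalence.from T-≡ x∈t))
                   | minWeightL-outside ts (t-disjoint (Equivalence.from T-≡ x∈t)) =
    trans (+-identityʳ _) (cong (c x *_) (sym (m≤n⇒m⊓n≡m (minWeight≤W (R t) x))))
  ... | false rewrite minWeight-outside t (≡false⇒¬T x∈t) with vsetL ts x
  ...   | true = cong (c x *_) (sym (m≥n⇒m⊓n≡n (minWeight≤W (RL ts) x)))
  ...   | false = refl

  ownCost-node : ∀ r ts x → ¬ T (vsetL ts r) → PairwiseDisjoint ts →
    ownCost (node r ts) x ≡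
    (if ⌊ x ≟ r ⌋ then c r * weight w (vset (node r ts)) else 0) + Σ-children ownCost ts x
  ownCost-node r ts x r∉ts disjoint rewrite Σ-ownCost ts x disjoint with x ≟ r
  ... | yes refl rewrite ¬T⇒≡false r∉ts | minWeightL-outside ts r∉ts =
    trans (cong (c x *_) (m≤n⇒m⊓n≡m (weight-mono w _))) (sym (+-identityʳ _))
  ... | no _ with vsetL ts x in x∈ts
  ...   | false = refl
  ...   | true = cong (c x *_) (m≥n⇒m⊓n≡n (≤-trans (minWeight-RL≤ ts (Equivalence.from T-≡ x∈ts))
                                                   (weight-mono w (Equivalence.from T-∨ ∘ inj₂))))

module _ {n : ℕ} (G : Graph n) (c w : Fin n → ℕ) where

  open Threshold w
  open Cost c w
  open DecisionTrees G
  open ≡-Reasoning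

  mutual
    cost-decomposition : ∀ {X t} → IsDT G X t → ∑[ x < n ] (w x * pathCost t x) ≡ ∑[ x < n ] ownCost t x
    cost-decomposition (dt {r} {ts} _ children unique) = begin
      ∑[ x < n ] (w x * pathCost D x)
        ≡⟨ sum-cong-≗ (λ x → cong (w x *_) (pathCost-node r ts x r∉ts disjoint)) ⟩
      ∑[ x < n ] (w x * ((if vset D x then c r else 0) + Σ-children pathCost ts x))
        ≡⟨ sum-cong-≗ (λ x → *-distribˡ-+ (w x) _ _) ⟩
      ∑[ x < n ] (w x * (if vset D x then c r else 0) + w x * Σ-children pathCost ts x)
        ≡⟨ ∑-distrib-+ (λ x → w x * (if vset D x then c r else 0))
                       (λ x → w x * Σ-children pathCost ts x) ⟩
      ∑[ x < n ] (w x * (if vset D x then c r else 0)) + ∑[ x < n ] (w x * Σ-children pathCost ts x)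
        ≡⟨ cong₂ _+_ (weight-scale w (c r) (vset D)) (children-cost-decomposition children) ⟩
      c r * weight w (vset D) + ∑[ x < n ] Σ-children ownCost ts x
        ≡⟨ cong (_+ _) (sym (∑-indicator r (c r * weight w (vset D)))) ⟩
      ∑[ x < n ] (if ⌊ x ≟ r ⌋ then c r * weight w (vset D) else 0) + ∑[ x < n ] Σ-children ownCost ts x
        ≡⟨ sym (∑-distrib-+ (λ x → if ⌊ x ≟ r ⌋ then c r * weight w (vset D) else 0)
                            (Σ-children ownCost ts)) ⟩
      ∑[ x < n ] ((if ⌊ x ≟ r ⌋ then c r * weight w (vset D) else 0) + Σ-children ownCost ts x)
        ≡⟨ sum-cong-≗ (λ x → sym (ownCost-node r ts x r∉ts disjoint)) ⟩
      ∑[ x < n ] ownCost D x ∎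
      where
      D = node r ts
      r∉ts = root∉children children
      disjoint = children-disjoint children unique

    children-cost-decomposition : ∀ {X r ts} → All (ChildOf X r) ts →
      ∑[ x < n ] (w x * Σ-children pathCost ts x) ≡ ∑[ x < n ] Σ-children ownCost ts x
    children-cost-decomposition [] = sum-cong-≗ (λ x → *-zeroʳ (w x))
    children-cost-decomposition {ts = t ∷ ts} ((_ , t-dt) ∷ children) = begin
      ∑[ x < n ] (w x * (pathCost t x + Σ-children pathCost ts x))
        ≡⟨ sum-cong-≗ (λ x → *-distribˡ-+ (w x) _ _) ⟩
      ∑[ x < n ] (w x * pathCost t x + w x * Σ-children pathCost ts x)
        ≡⟨ ∑-distrib-+ (λ x → w x * pathCost t x) (λ x → w x * Σ-children pathCost ts x) ⟩
      ∑[ x < n ] (w x * pathCost t x) + ∑[ x < n ] (w x * Σ-children pathCost ts x)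
        ≡⟨ cong₂ _+_ (cost-decomposition t-dt) (children-cost-decomposition children) ⟩
      ∑[ x < n ] ownCost t x + ∑[ x < n ] Σ-children ownCost ts x
        ≡⟨ sym (∑-distrib-+ (ownCost t) (Σ-children ownCost ts)) ⟩
      ∑[ x < n ] Σ-children ownCost (t ∷ ts) x ∎

  cost≡∑minWeight : ∀ {D} → IsDT G full D → cost c w D ≡ ∑[ x < n ] (c x * minWeight (R D) x)
  cost≡∑minWeight {D} D-dt = begin
    cost c w D                            ≡⟨ ΣV≡∑ (λ x → w x * pathCost D x) ⟩
    ∑[ x < n ] (w x * pathCost D x)       ≡⟨ cost-decomposition D-dt ⟩
    ∑[ x < n ] ownCost D x                ≡⟨ sum-cong-≗ (λ x → cong (if_then c x * minWeight (R D) x else 0)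
                                                                 (Equivalence.to T-≡ (vertices⊆vset D-dt _))) ⟩
    ∑[ x < n ] (c x * minWeight (R D) x)  ∎

lemma2 : ∀ {n} (G : Graph n) → Connected G → (c w : Fin n → ℕ) →
         (Dstar : Tree n) → IsDT G full Dstar →
         (opt : ℕ) → IsOPT G c w opt → cost c w Dstar ≡ opt →
         opt ≡ sum (map (λ k → weight c (inS w Dstar k)) (upTo (weight w full)))
lemma2 {n} G _ c w D D-dt opt _ cost≡opt = begin
  opt
    ≡⟨ sym cost≡opt ⟩
  cost c w D
    ≡⟨ cost≡∑minWeight G c w D-dt ⟩
  ∑[ x < n ] (c x * minWeight (R D) x)
    ≡⟨ ∑-layers c (minWeight (R D)) (minWeight≤W (R D)) ⟩
  ∑[ k < W ] ∑[ x < n ] (if toℕ k <ᵇ minWeight (R D) x then c x else 0)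
    ≡⟨ sum-cong-≗ (λ k → sym (weight-inS D c (toℕ<n k))) ⟩
  ∑[ k < W ] weight c (inS w D (toℕ k))
    ≡⟨ sym (sum-upTo W (λ k → weight c (inS w D k))) ⟩
  sum (map (λ k → weight c (inS w D k)) (upTo W)) ∎
  where
  open Threshold w
  open ≡-Reasoning
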